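{- Let $F$ be a CNF formula in which no variable occurs more than twice and no literal occurs more than once. If the stage algorithm fails (at some stage), then $F$ is unsatisfiable.
   Context: $F=C_1\wedge\cdots\wedge C_m$, each clause a set of literals coded by natural numbers; $\overline l$ is the complement of $l$; the first literal of a clause is its literal with least code. A pure literal occurs in $F$ while its complement does not. $follows(l_1,l_2)$ holds if $l_1,l_2$ lie in the same clause and $l_1$ is the cyclic successor of $l_2$ in that clause w.r.t. the numerical order of codes (a single literal follows itself). For non-pure $l$, $next(l)$ is the literal following $\overline l$; for pure $l$, $next(l)=l$. The algorithm processes stages $i=1,\dots,m$ in order, maintaining a truth assignment, where "assign true to $l$" sets the variable of $l$ so that $l$ is true (overriding earlier values). Stage $i$: set $l_1$ to the first literal of clause $i$; repeat: \{assign true to $l_1$; set $l_2:=next(l_1)$; while $l_2\ne\overline{l_1}$: \{assign true to $l_2$; set $l_2:=next(l_2)$; if $l_2$ is a pure literal, assign true to $l_2$ and stage $i$ is done; if $l_1$ and $l_2$ are in the same clause, stage $i$ is done\}; assign true to $l_1$; set $l_1:=next(l_1)$\} until $l_1$ is the first literal in clause $i$. If this repeat loop terminates (without stage $i$ being done), the algorithm fails at stage $i$. -}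

module Defs where

open import Data.Nat using (ℕ; zero; suc; _+_; _≤_; _<_; _≟_; _/_)
open import Data.Nat.Properties using ()
open import Data.Bool using (Bool; true; false; not)
open import Data.List using (List; []; _∷_; _++_; map)
open import Data.Nat.ListAction using (sum)
open import Data.List.Membership.Propositional using (_∈_)
open import Data.List.Relation.Unary.Any using (Any)
open import Data.List.Relation.Unary.All using (All)
open import Data.Product using (Σ; _×_; ∃; ∃-syntax)
open import Data.Sum using (_⊎_)
open import Relation.Nullary using (¬_; yes; no)
open import Relation.Binary.PropositionalEquality using (_≡_; _≢_)

-- Literal coding convention: variable v has positive literal 2v and
-- negative literal 2v+1.  Complement flips the last bit.

Literal : Set
Literal = ℕ

Clause : Set
Clause = List Literal   -- read as a set of literals

CNF : Set
CNF = List Clause       -- C₁ ∧ ⋯ ∧ Cₘ, in order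

comp : Literal → Literal
comp zero = 1
comp (suc zero) = zero
comp (suc (suc n)) = suc (suc (comp n))

isNeg : Literal → Bool
isNeg zero = false
isNeg (suc zero) = true
isNeg (suc (suc n)) = isNeg n

var : Literal → ℕ
var l = l / 2

Assignment : Set
Assignment = ℕ → Bool

litVal : Assignment → Literal → Bool
litVal σ l with isNeg l
... | false = σ (var l)
... | true  = not (σ (var l))

Satisfies : Assignment → CNF → Set
Satisfies σ F = All (λ C → ∃[ l ] (l ∈ C × litVal σ l ≡ true)) F

Satisfiable : CNF → Set
Satisfiable F = ∃[ σ ] Satisfies σ F

Unsatisfiable : CNF → Set
Unsatisfiable F = ¬ Satisfiable F

countIn : Literal → Clause → ℕ
countIn l [] = zero
countIn l (x ∷ C) with x ≟ l
... | yes _ = suc (countIn l C)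
... | no  _ = countIn l C

occ : CNF → Literal → ℕ
occ F l = sum (map (countIn l) F)

LiteralsAtMostOnce : CNF → Set
LiteralsAtMostOnce F = ∀ l → occ F l ≤ 1

VariablesAtMostTwice : CNF → Set
VariablesAtMostTwice F = ∀ l → occ F l + occ F (comp l) ≤ 2

Occurs : CNF → Literal → Set
Occurs F l = Any (l ∈_) F

Pure : CNF → Literal → Set
Pure F l = Occurs F l × ¬ Occurs F (comp l)

SameClause : CNF → Literal → Literal → Set
SameClause F l₁ l₂ = Any (λ C → l₁ ∈ C × l₂ ∈ C) F

-- first literal of a clause: the one with least code
FirstLit : Clause → Literal → Set
FirstLit C f = f ∈ C × (∀ {z} → z ∈ C → f ≤ z)

-- y is the cyclic successor of x in C w.r.t. the numerical order of codes
CycSucc : Clause → Literal → Literal → Set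
CycSucc C x y =
  x ∈ C × y ∈ C ×
  ( (x < y × (∀ {z} → z ∈ C → x < z → y ≤ z))
  ⊎ ((∀ {z} → z ∈ C → z ≤ x) × (∀ {z} → z ∈ C → y ≤ z)) )

-- follows(l₁,l₂): l₁, l₂ in the same clause, l₁ the cyclic successor of l₂
Follows : CNF → Literal → Literal → Set
Follows F l₁ l₂ = Any (λ C → CycSucc C l₂ l₁) F

-- next(l) (as a relation; functional under the hypotheses of the theorem)
Next : CNF → Literal → Literal → Set
Next F l l' = (Pure F l × l' ≡ l) ⊎ (¬ Pure F l × Follows F l' (comp l))

-- Big-step semantics of one stage (control flow only; the control flow
-- does not depend on the truth assignment being built).

data InnerResult : Set where
  done  : InnerResult
  exit  : InnerResult   -- while loop exited because l₂ = comp l₁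

data StageResult : Set where
  stageDone : StageResult
  stageFail : StageResult

-- Inner F l₁ l₂ r : the while loop, started with current value l₂,
-- terminates with result r.
data Inner (F : CNF) (l₁ : Literal) : Literal → InnerResult → Set where
  stop     : ∀ {l₂} → l₂ ≡ comp l₁ → Inner F l₁ l₂ exit
  stepPure : ∀ {l₂ l₂'} → l₂ ≢ comp l₁ → Next F l₂ l₂' → Pure F l₂' →
             Inner F l₁ l₂ done
  stepSame : ∀ {l₂ l₂'} → l₂ ≢ comp l₁ → Next F l₂ l₂' → ¬ Pure F l₂' →
             SameClause F l₁ l₂' → Inner F l₁ l₂ done
  stepCont : ∀ {l₂ l₂' r} → l₂ ≢ comp l₁ → Next F l₂ l₂' → ¬ Pure F l₂' →
             ¬ SameClause F l₁ l₂' → Inner F l₁ l₂' r → Inner F l₁ l₂ r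

-- Outer F f l₁ r : the repeat loop (with f the first literal of the
-- clause), entering the body with current value l₁, terminates with r.
data Outer (F : CNF) (f : Literal) : Literal → StageResult → Set where
  bodyDone : ∀ {l₁ l₂} → Next F l₁ l₂ → Inner F l₁ l₂ done →
             Outer F f l₁ stageDone
  bodyEnd  : ∀ {l₁ l₂ l₁'} → Next F l₁ l₂ → Inner F l₁ l₂ exit →
             Next F l₁ l₁' → l₁' ≡ f → Outer F f l₁ stageFail
  bodyCont : ∀ {l₁ l₂ l₁' r} → Next F l₁ l₂ → Inner F l₁ l₂ exit →
             Next F l₁ l₁' → l₁' ≢ f → Outer F f l₁' r → Outer F f l₁ r

-- Stage F C r : the stage for clause C of F terminates with result r.
-- (An empty clause has no first literal; we let its stage fail, which
-- only strengthens the theorem, since such an F is unsatisfiable.)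
data Stage (F : CNF) : Clause → StageResult → Set where
  stageEmpty : Stage F [] stageFail
  stageRun   : ∀ {C f r} → FirstLit C f → Outer F f f r → Stage F C r

AlgorithmFails : CNF → Set
AlgorithmFails F =
  Σ CNF λ pre → Σ Clause λ C → Σ CNF λ post →
    F ≡ pre ++ C ∷ post × All (λ D → Stage F D stageDone) pre × Stage F C stageFail

module Submission where

-- Theorem 11: if no literal occurs twice in F and the stage algorithm fails,
-- then F is unsatisfiable.
--
-- Since every literal lies in at most one clause, next is a
-- function, and in the failing stage both loops walk along one orbit
-- a 0 = f, a (t+1) = next (a t): the repeat loop visits the a t in turn,
-- and the while loop started at a t runs over a (t+1), a (t+2), … until it
-- returns to comp (a t) at time ret t.  Write home t for the clause of
-- comp (a t); then a (t+1) is the cyclic successor of comp (a t) in home t.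
-- Assume σ satisfies F.  We show that every a t is false, by strong
-- induction on ret t.  The literals of home t met strictly inside the loop
-- of t have their own loops nested inside it (lemma nested), hence are
-- false; and after such a literal's loop returns, the orbit continues
-- with its cyclic successor in home t (lemma resume).  So the loop of t
-- sweeps the whole cycle of home t from comp (a t) back to itself through
-- false literals; by a purely order-theoretic fact (sweep) it thus meets
-- every literal of home t, so the only true literal of home t is comp (a t),
-- i.e. a t is false.  Finally a 0 and a (ret 0) = comp (a 0) cannot both be
-- false.

open import Defs
open import Data.Nat using (ℕ; zero; suc; _+_; _≤_; _<_; _≟_; _/_; z≤n; s≤s; s≤s⁻¹)
open import Data.Nat.Properties
open import Data.Nat.DivMod using (m/n≡1+[m∸n]/n)
open import Data.Bool using (true; false; not; _xor_)
open import Data.Bool.Properties using (not-distribˡ-xor; not-injective)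
open import Data.List using (_∷_)
open import Data.List.Membership.Propositional using (_∈_; find; lose)
open import Data.List.Membership.Propositional.Properties using (∈-++⁺ʳ)
open import Data.List.Relation.Unary.Any using (here; there)
import Data.List.Relation.Unary.All as All
open import Data.Product using (Σ; _×_; _,_; proj₁; proj₂)
open import Data.Sum using (_⊎_; inj₁; inj₂)
open import Data.Empty using (⊥; ⊥-elim)
open import Relation.Nullary using (¬_; yes; no)
open import Relation.Binary using (tri<; tri≈; tri>)
open import Relation.Binary.PropositionalEquality

comp-involutive : ∀ x → comp (comp x) ≡ x
comp-involutive zero = refl
comp-involutive (suc zero) = refl
comp-involutive (suc (suc n)) = cong (λ k → suc (suc k)) (comp-involutive n)

comp-injective : ∀ {x y} → comp x ≡ comp y → x ≡ y
comp-injective {x} {y} eq =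
  trans (sym (comp-involutive x)) (trans (cong comp eq) (comp-involutive y))

isNeg-comp : ∀ x → isNeg (comp x) ≡ not (isNeg x)
isNeg-comp zero = refl
isNeg-comp (suc zero) = refl
isNeg-comp (suc (suc n)) = isNeg-comp n

var-comp : ∀ x → var (comp x) ≡ var x
var-comp zero = refl
var-comp (suc zero) = refl
var-comp (suc (suc n)) =
  trans (halve (comp n)) (trans (cong suc (var-comp n)) (sym (halve n)))
  where
    halve : ∀ m → suc (suc m) / 2 ≡ suc (m / 2)
    halve m = m/n≡1+[m∸n]/n {suc (suc m)} {2} (s≤s (s≤s z≤n))

litVal-xor : ∀ σ l → litVal σ l ≡ isNeg l xor σ (var l)
litVal-xor σ l with isNeg l
... | true = refl
... | false = refl

litVal-comp : ∀ σ x → litVal σ (comp x) ≡ not (litVal σ x)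
litVal-comp σ x = begin
  litVal σ (comp x)                    ≡⟨ litVal-xor σ (comp x) ⟩
  isNeg (comp x) xor σ (var (comp x))  ≡⟨ cong₂ (λ b v → b xor σ v) (isNeg-comp x) (var-comp x) ⟩
  not (isNeg x) xor σ (var x)          ≡⟨ sym (not-distribˡ-xor (isNeg x) _) ⟩
  not (isNeg x xor σ (var x))          ≡⟨ cong not (sym (litVal-xor σ x)) ⟩
  not (litVal σ x)                     ∎
  where open ≡-Reasoning

comp-true⇒false : ∀ σ {x} → litVal σ (comp x) ≡ true → litVal σ x ≡ false
comp-true⇒false σ {x} t = not-injective (trans (sym (litVal-comp σ x)) t)

false≢true-lit : ∀ σ {x y} → litVal σ x ≡ false → litVal σ y ≡ true → x ≢ y
false≢true-lit σ fx ty refl with trans (sym fx) ty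
... | ()

countIn-pos : ∀ {l C} → l ∈ C → 1 ≤ countIn l C
countIn-pos {l} {y ∷ C} (here refl) with y ≟ l
... | yes _ = s≤s z≤n
... | no y≢l = ⊥-elim (y≢l refl)
countIn-pos {l} {y ∷ C} (there l∈C) with y ≟ l
... | yes _ = ≤-trans (countIn-pos l∈C) (n≤1+n _)
... | no _ = countIn-pos l∈C

occ-pos : ∀ {l C G} → C ∈ G → l ∈ C → 1 ≤ occ G l
occ-pos {l} {C} {D ∷ G} (here refl) l∈C = ≤-trans (countIn-pos l∈C) (m≤m+n _ _)
occ-pos {l} {C} {D ∷ G} (there C∈G) l∈C = ≤-trans (occ-pos C∈G l∈C) (m≤n+m _ (countIn l D))

unique-clause : ∀ G {x C D} → occ G x ≤ 1 → C ∈ G → D ∈ G → x ∈ C → x ∈ D → C ≡ D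
unique-clause (E ∷ G) once (here C≡E) (here D≡E) _ _ = trans C≡E (sym D≡E)
unique-clause (E ∷ G) once (here refl) (there D∈G) x∈C x∈D =
  ⊥-elim (<⇒≱ (+-mono-≤ (countIn-pos x∈C) (occ-pos D∈G x∈D)) once)
unique-clause (E ∷ G) once (there C∈G) (here refl) x∈C x∈D =
  ⊥-elim (<⇒≱ (+-mono-≤ (countIn-pos x∈D) (occ-pos C∈G x∈C)) once)
unique-clause (E ∷ G) {x} once (there C∈G) (there D∈G) x∈C x∈D =
  unique-clause G (≤-trans (m≤n+m _ (countIn x E)) once) C∈G D∈G x∈C x∈D

cycSucc-functional : ∀ {C x y y'} → CycSucc C x y → CycSucc C x y' → y ≡ y'
cycSucc-functional (_ , y∈C , inj₁ (x<y , least)) (_ , y'∈C , inj₁ (x<y' , least')) =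
  ≤-antisym (least y'∈C x<y') (least' y∈C x<y)
cycSucc-functional (_ , y∈C , inj₁ (x<y , _)) (_ , _ , inj₂ (x-max , _)) =
  ⊥-elim (<⇒≱ x<y (x-max y∈C))
cycSucc-functional (_ , _ , inj₂ (x-max , _)) (_ , y'∈C , inj₁ (x<y' , _)) =
  ⊥-elim (<⇒≱ x<y' (x-max y'∈C))
cycSucc-functional (_ , y∈C , inj₂ (_ , y-min)) (_ , y'∈C , inj₂ (_ , y'-min)) =
  ≤-antisym (y-min y'∈C) (y'-min y∈C)

-- Between s z y: going cyclically upwards from s, one meets y strictly
-- before z.
Between : Literal → Literal → Literal → Set
Between s z y = (s < z → s < y × y < z) × (z < s → s < y ⊎ y < z)

between-start : ∀ {C s y z} → CycSucc C s y → z ∈ C → y ≢ z → Between s z y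
between-start (_ , _ , inj₁ (s<y , least)) z∈C y≢z =
  (λ s<z → s<y , ≤∧≢⇒< (least z∈C s<z) y≢z) , (λ _ → inj₁ s<y)
between-start (_ , _ , inj₂ (s-max , y-min)) z∈C y≢z =
  (λ s<z → ⊥-elim (<⇒≱ s<z (s-max z∈C))) , (λ _ → inj₂ (≤∧≢⇒< (y-min z∈C) y≢z))

between-step : ∀ {C s y y' z} → Between s z y → CycSucc C y y' → z ∈ C → y' ≢ z →
               Between s z y'
between-step (below , wrapped) (_ , _ , inj₁ (y<y' , least)) z∈C y'≢z =
  (λ s<z → <-trans (proj₁ (below s<z)) y<y' , ≤∧≢⇒< (least z∈C (proj₂ (below s<z))) y'≢z) ,
  (λ z<s → advance (wrapped z<s))
  where
    advance : _ ⊎ _ → _ ⊎ _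
    advance (inj₁ s<y) = inj₁ (<-trans s<y y<y')
    advance (inj₂ y<z) = inj₂ (≤∧≢⇒< (least z∈C y<z) y'≢z)
between-step (below , _) (_ , _ , inj₂ (y-max , y'-min)) z∈C y'≢z =
  (λ s<z → ⊥-elim (<⇒≱ (proj₂ (below s<z)) (y-max z∈C))) ,
  (λ _ → inj₂ (≤∧≢⇒< (y'-min z∈C) y'≢z))

between-self : ∀ {s z} → z ≢ s → ¬ Between s z s
between-self {s} {z} z≢s (below , wrapped) with <-cmp s z
... | tri< s<z _ _ = <-irrefl refl (proj₁ (below s<z))
... | tri≈ _ s≡z _ = z≢s (sym s≡z)
... | tri> _ _ z<s with wrapped z<s
...   | inj₁ s<s = <-irrefl refl s<s
...   | inj₂ s<z = <-asym s<z z<s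

-- SuccWalk C z y s: iterating the cyclic successor of C from y reaches s,
-- and every literal visited on the way (s included) differs from z.
data SuccWalk (C : Clause) (z : Literal) : Literal → Literal → Set where
  arrived : ∀ {s} → z ≢ s → SuccWalk C z s s
  step    : ∀ {y y' s} → y ≢ z → CycSucc C y y' → SuccWalk C z y' s → SuccWalk C z y s

walk-avoids : ∀ {C z y s} → SuccWalk C z y s → y ≢ z
walk-avoids (arrived z≢s) y≡z = z≢s (sym y≡z)
walk-avoids (step y≢z _ _) = y≢z

-- Sweep: the successor walk from the successor of s back to s meets every
-- literal of C.
sweep : ∀ {C s y z} → z ∈ C → CycSucc C s y → ¬ SuccWalk C z y s
sweep {C} {s} {y} {z} z∈C s↦y walk = go walk (between-start s↦y z∈C (walk-avoids walk))
  where
    go : ∀ {y} → SuccWalk C z y s → Between s z y → ⊥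
    go (arrived z≢s) b = between-self z≢s b
    go (step _ y↦y' rest) b = go rest (between-step b y↦y' z∈C (walk-avoids rest))

module Orbits (F : CNF) (once : LiteralsAtMostOnce F) where

  unique-clauseF : ∀ {x C D} → C ∈ F → D ∈ F → x ∈ C → x ∈ D → C ≡ D
  unique-clauseF {x} = unique-clause F (once x)

  together : ∀ {C x y} → C ∈ F → x ∈ C → y ∈ C → SameClause F x y
  together C∈F x∈C y∈C = lose C∈F (x∈C , y∈C)

  next-in-clause : ∀ {l y C} → Next F l y → C ∈ F → comp l ∈ C → CycSucc C (comp l) y
  next-in-clause (inj₁ ((_ , comp-absent) , _)) C∈F c∈C = ⊥-elim (comp-absent (lose C∈F c∈C))
  next-in-clause (inj₂ (_ , follows)) C∈F c∈C with find follows
  ... | D , D∈F , c↦y with unique-clauseF D∈F C∈F (proj₁ c↦y) c∈C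
  ... | refl = c↦y

  next-functional : ∀ {l y y'} → Next F l y → Next F l y' → y ≡ y'
  next-functional (inj₁ (_ , refl)) (inj₁ (_ , refl)) = refl
  next-functional (inj₁ (pure , _)) (inj₂ (impure , _)) = ⊥-elim (impure pure)
  next-functional (inj₂ (impure , _)) (inj₁ (pure , _)) = ⊥-elim (impure pure)
  next-functional (inj₂ (_ , follows)) next'@(inj₂ _) with find follows
  ... | C , C∈F , c↦y = cycSucc-functional c↦y (next-in-clause next' C∈F (proj₁ c↦y))

  next-occurs : ∀ {l y} → Next F l y → Occurs F y
  next-occurs (inj₁ ((occurs , _) , refl)) = occurs
  next-occurs (inj₂ (_ , follows)) with find follows
  ... | C , C∈F , c↦y = lose C∈F (proj₁ (proj₂ c↦y))

  IsOrbit : (ℕ → Literal) → Set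
  IsOrbit a = ∀ t → Next F (a t) (a (suc t))

  record LoopExit (a : ℕ → Literal) (l₁ : Literal) (p : ℕ) : Set where
    field
      exitTime : ℕ
      starts   : p ≤ exitTime
      hitsComp : a exitTime ≡ comp l₁
      firstHit : ∀ {q} → p ≤ q → q < exitTime → a q ≢ comp l₁
      apart    : ∀ {q} → p < q → q ≤ exitTime → ¬ SameClause F l₁ (a q)
  open LoopExit

  loopExit : ∀ {a l₁ p x} → IsOrbit a → a p ≡ x → Inner F l₁ x exit → LoopExit a l₁ p
  loopExit {p = p} orbit refl (stop hit) = record
    { exitTime = p ; starts = ≤-refl ; hitsComp = hit
    ; firstHit = λ p≤q q<p _ → <⇒≱ q<p p≤q
    ; apart = λ p<q q≤p → ⊥-elim (<⇒≱ p<q q≤p) }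
  loopExit {a} {l₁} {p} orbit refl (stepCont {l₂' = l₂'} miss next _ notSame inner) = record
    { exitTime = exitTime rest ; starts = ≤-trans (n≤1+n p) (starts rest)
    ; hitsComp = hitsComp rest ; firstHit = firstHit' ; apart = apart' }
    where
      next≡ : a (suc p) ≡ l₂'
      next≡ = next-functional (orbit p) next
      rest : LoopExit a l₁ (suc p)
      rest = loopExit orbit next≡ inner
      firstHit' : ∀ {q} → p ≤ q → q < exitTime rest → a q ≢ comp l₁
      firstHit' p≤q q<e with m≤n⇒m<n∨m≡n p≤q
      ... | inj₁ p<q = firstHit rest p<q q<e
      ... | inj₂ refl = miss
      apart' : ∀ {q} → p < q → q ≤ exitTime rest → ¬ SameClause F l₁ (a q)
      apart' p<q q≤e with m≤n⇒m<n∨m≡n p<q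
      ... | inj₁ p+1<q = apart rest p+1<q q≤e
      ... | inj₂ refl = subst (λ x → ¬ SameClause F l₁ x) (sym next≡) notSame

  module FailingOrbit (a : ℕ → Literal) (orbit : IsOrbit a)
                      (loops : ∀ t → LoopExit a (a t) (suc t)) where

    ret : ℕ → ℕ
    ret t = exitTime (loops t)

    returns : ∀ t → a (ret t) ≡ comp (a t)
    returns t = hitsComp (loops t)

    after : ∀ t → suc t ≤ ret t
    after t = starts (loops t)

    comp-occurs : ∀ t → Occurs F (comp (a t))
    comp-occurs t with ret t | returns t | after t
    ... | suc r | hit | _ = subst (Occurs F) hit (next-occurs (orbit r))

    home : ℕ → Clause
    home t = proj₁ (find (comp-occurs t))

    home-∈ : ∀ t → home t ∈ F
    home-∈ t = proj₁ (proj₂ (find (comp-occurs t)))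

    comp-∈-home : ∀ t → comp (a t) ∈ home t
    comp-∈-home t = proj₂ (proj₂ (find (comp-occurs t)))

    home-succ : ∀ t → CycSucc (home t) (comp (a t)) (a (suc t))
    home-succ t = next-in-clause (orbit t) (home-∈ t) (comp-∈-home t)

    resume : ∀ {p D} → D ∈ F → a p ∈ D → CycSucc D (a p) (a (suc (ret p)))
    resume {p} {D} D∈F p∈D =
      subst (λ x → CycSucc D x (a (suc (ret p)))) back
        (next-in-clause (orbit (ret p)) D∈F (subst (_∈ D) (sym back) p∈D))
      where
        back : comp (a (ret p)) ≡ a p
        back = trans (cong comp (returns p)) (comp-involutive (a p))

    -- A literal of home t met at time p, strictly inside the loop of t,
    -- cannot have its loop end at or after the end of t's loop: its loop
    -- would meet comp (a t) ∈ home t, or start right on it.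
    notOutside : ∀ {t p} → t < p → p < ret t → a p ∈ home t → ret t ≤ ret p → ⊥
    notOutside {t} {p} t<p p<r p∈H r≤r' with m≤n⇒m<n∨m≡n p<r
    ... | inj₁ p+1<r =
      apart (loops p) p+1<r r≤r'
        (together (home-∈ t) p∈H (subst (_∈ home t) (sym (returns t)) (comp-∈-home t)))
    ... | inj₂ p+1≡r = startsOnReturn (m≤n⇒m<n∨m≡n (after p))
      where
        succ-is-return : a (suc p) ≡ comp (a t)
        succ-is-return = trans (cong a p+1≡r) (returns t)
        startsOnReturn : suc p < ret p ⊎ suc p ≡ ret p → ⊥
        startsOnReturn (inj₂ p+1≡r') =
          firstHit (loops t) ≤-refl (≤-<-trans t<p p<r)
            (trans (next-functional (orbit t) (subst (λ x → Next F x (a (suc p))) same (orbit p)))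
                   succ-is-return)
          where
            same : a p ≡ a t
            same = comp-injective (trans (sym (trans (cong a p+1≡r') (returns p))) succ-is-return)
        startsOnReturn (inj₁ p+1<r') =
          apart (loops p) p+1<r' ≤-refl
            (together (home-∈ t) p∈H (subst (_∈ home t) (sym (returns p)) comp-p∈H))
          where
            -- home p and home t share a (p+1) = comp (a t).
            same-home : home p ≡ home t
            same-home = unique-clauseF (home-∈ p) (home-∈ t) (proj₁ (proj₂ (home-succ p)))
                          (subst (_∈ home t) (sym succ-is-return) (comp-∈-home t))
            comp-p∈H : comp (a p) ∈ home t
            comp-p∈H = subst (comp (a p) ∈_) same-home (comp-∈-home p)

    nested : ∀ {t p} → t < p → p < ret t → a p ∈ home t → ret p < ret t
    nested {t} {p} t<p p<r p∈H with ret p <? ret t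
    ... | yes r'<r = r'<r
    ... | no r'≮r = ⊥-elim (notOutside t<p p<r p∈H (≮⇒≥ r'≮r))

    module UnderModel (σ : Assignment) (sat : Satisfies σ F) where

      -- Given that the literals whose loops end before ret t are false, and
      -- z is true, the loop of t walks through home t from the literal met
      -- at time p back to comp (a t) avoiding z (n bounds the remaining time).
      walk : ∀ {t z} → (∀ p → ret p < ret t → litVal σ (a p) ≡ false) →
             litVal σ z ≡ true → z ≢ comp (a t) →
             ∀ n {p} → ret t ≤ n + p → t < p → p ≤ ret t → a p ∈ home t →
             SuccWalk (home t) z (a p) (comp (a t))
      walk {t} {z} shorter z-true z≢c n {p} bound t<p p≤r p∈H with m≤n⇒m<n∨m≡n p≤r
      ... | inj₂ refl = subst (SuccWalk (home t) z (a p)) (returns t) (arrived (subst (z ≢_) (sym (returns t)) z≢c))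
      walk {t} {z} shorter z-true z≢c zero {p} bound t<p p≤r p∈H | inj₁ p<r =
        ⊥-elim (<⇒≱ p<r bound)
      walk {t} {z} shorter z-true z≢c (suc n) {p} bound t<p p≤r p∈H | inj₁ p<r =
        step (false≢true-lit σ (shorter p inner) z-true) (resume (home-∈ t) p∈H)
          (walk shorter z-true z≢c n bound' (<-trans t<p p<r') inner
                (proj₁ (proj₂ (resume (home-∈ t) p∈H))))
        where
          inner : ret p < ret t
          inner = nested t<p p<r p∈H
          p<r' : p < suc (ret p)
          p<r' = ≤-trans (after p) (n≤1+n _)
          bound' : ret t ≤ n + suc (ret p)
          bound' = ≤-trans bound (subst (suc (n + p) ≤_) (sym (+-suc n (ret p)))
                                   (s≤s (+-monoʳ-≤ n (<⇒≤ (after p)))))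

      -- Strong induction on ret t, with fuel n.
      falseBelow : ∀ n t → ret t < n → litVal σ (a t) ≡ false
      falseBelow (suc n) t r<n with All.lookup sat (home-∈ t)
      ... | z , z∈H , z-true with z ≟ comp (a t)
      ...   | yes refl = comp-true⇒false σ {a t} z-true
      ...   | no z≢c = ⊥-elim (sweep z∈H (home-succ t)
                 (walk shorter z-true z≢c (ret t) (m≤m+n (ret t) (suc t)) (n<1+n t) (after t)
                       (proj₁ (proj₂ (home-succ t)))))
        where
          shorter : ∀ p → ret p < ret t → litVal σ (a p) ≡ false
          shorter p r'<r = falseBelow n p (<-≤-trans r'<r (s≤s⁻¹ r<n))

      allFalse : ∀ t → litVal σ (a t) ≡ false
      allFalse t = falseBelow (suc (ret t)) t ≤-refl

      noModel : ⊥
      noModel with (begin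
          false                   ≡⟨ sym (allFalse (ret 0)) ⟩
          litVal σ (a (ret 0))    ≡⟨ cong (litVal σ) (returns 0) ⟩
          litVal σ (comp (a 0))   ≡⟨ litVal-comp σ (a 0) ⟩
          not (litVal σ (a 0))    ≡⟨ cong not (allFalse 0) ⟩
          true                    ∎)
        where open ≡-Reasoning
      ... | ()

  -- A failing repeat loop with first literal f, read as an orbit: from each
  -- literal where the loop body is entered the body's while loop exits, and
  -- the loop is entered again at next of it (or at f again, when it ends).
  module FailingStage {f : Literal} (run : Outer F f f stageFail) where

    Failing : Literal → Set
    Failing l = Outer F f l stageFail

    advance : ∀ {l} → Failing l → Σ Literal λ l' → Next F l l' × Failing l'
    advance (bodyEnd _ _ next l'≡f) = _ , next , subst Failing (sym l'≡f) run
    advance (bodyCont _ _ next _ rest) = _ , next , rest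

    body : ∀ {l} → Failing l → Σ Literal λ l₂ → Next F l l₂ × Inner F l l₂ exit
    body (bodyEnd next inner _ _) = _ , next , inner
    body (bodyCont next inner _ _ _) = _ , next , inner

    states : ℕ → Σ Literal Failing
    states zero = f , run
    states (suc t) with advance (proj₂ (states t))
    ... | l' , _ , failing = l' , failing

    a : ℕ → Literal
    a t = proj₁ (states t)

    orbit : IsOrbit a
    orbit t with advance (proj₂ (states t))
    ... | _ , next , _ = next

    loops : ∀ t → LoopExit a (a t) (suc t)
    loops t with body (proj₂ (states t))
    ... | _ , next , inner =
      loopExit orbit (next-functional (orbit t) next) inner

mainTheorem11 : (F : CNF) → VariablesAtMostTwice F → LiteralsAtMostOnce F →
    AlgorithmFails F → Unsatisfiable F
mainTheorem11 F _ once (pre , C , post , F≡ , _ , fails) (σ , sat) = noModelFor fails C∈F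
  where
    open Orbits F once
    C∈F : C ∈ F
    C∈F = subst (C ∈_) (sym F≡) (∈-++⁺ʳ pre (here refl))
    noModelFor : ∀ {C} → Stage F C stageFail → C ∈ F → ⊥
    noModelFor stageEmpty empty∈F with All.lookup sat empty∈F
    ... | _ , () , _
    noModelFor (stageRun _ run) _ = UnderModel.noModel σ sat
      where open FailingStage run
            open FailingOrbit a orbit loops
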